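{- Let $G=(V,E)$ be an event graph. Then $\mathrm{dec}(G)$ contains a unique sink component $\mathcal C$ such that, for every node $v\in V$, $\mathcal C$ is the only sink component of $\mathrm{dec}(G)$ that is reachable (by a directed walk) from the node $(v,\emptyset)$.
   Context: An event graph is a finite, connected, undirected graph $G=(V,E)$ in which every node $v$ carries a label of the form $\texttt{i}x_v$ (insert) or $\texttt{d}x_v$ (delete), where $x_v$ is an element of a finite universe $\mathcal U$. Let $\mathcal U_{|V}=\{x_v : v\in V\}$. It is assumed that for every $x\in\mathcal U_{|V}$ there is at least one node labeled $\texttt{i}x$ and at least one node labeled $\texttt{d}x$. The decorated graph $\mathrm{dec}(G)$ is the directed graph with vertex set $V\times 2^{\mathcal U_{|V}}$, in which $((u,X),(v,Y))$ is an edge iff $\{u,v\}\in E$ and $Y=X\cup\{x_v\}$ if $v$ is labeled $\texttt{i}x_v$, resp. $Y=X\setminus\{x_v\}$ if $v$ is labeled $\texttt{d}x_v$. A sink component of $\mathrm{dec}(G)$ is a strongly connected component with no edges leaving it. -}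

module Defs where

open import Data.Nat using (ℕ)
open import Data.Bool using (Bool; T)
open import Data.Fin using (Fin)
open import Data.Fin.Subset using (Subset; ⊥; ⁅_⁆; _∪_; _-_; _∈_)
open import Data.Fin.Subset.Properties using (∉⊥)
open import Data.Product using (Σ; ∃; _×_; _,_; proj₁)
open import Data.Empty using (⊥-elim)
open import Relation.Nullary using (¬_)
open import Relation.Binary.PropositionalEquality using (_≡_)
open import Relation.Binary.Construct.Closure.ReflexiveTransitive using (Star)

data Op : Set where
  ins del : Op

record EventGraph (n m : ℕ) : Set where
  field
    adj       : Fin n → Fin n → Bool
    adj-sym   : ∀ u v → adj u v ≡ adj v u
    adj-irr   : ∀ v → ¬ T (adj v v)
    nonempty  : Fin n
    connected : ∀ u v → Star (λ a b → T (adj a b)) u v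
    kind      : Fin n → Op
    elem      : Fin n → Fin m
    hasIns    : ∀ v → ∃ λ w → elem w ≡ elem v × kind w ≡ ins
    hasDel    : ∀ v → ∃ λ w → elem w ≡ elem v × kind w ≡ del

module _ {n m : ℕ} (G : EventGraph n m) where
  open EventGraph G

  Adj : Fin n → Fin n → Set
  Adj u v = T (adj u v)

  InU : Fin m → Set
  InU x = ∃ λ v → elem v ≡ x

  -- subsets of U_{|V}, represented as subsets of U contained in U_{|V}
  SubU : Set
  SubU = Σ (Subset m) (λ X → ∀ x → x ∈ X → InU x)

  -- vertices of dec(G): V × 2^{U_{|V}}
  DNode : Set
  DNode = Fin n × SubU

  step : Fin n → Subset m → Subset m
  step v X with kind v
  ... | ins = X ∪ ⁅ elem v ⁆
  ... | del = X - elem v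

  DEdge : DNode → DNode → Set
  DEdge (u , X , _) (v , Y , _) = Adj u v × Y ≡ step v X

  Reach : DNode → DNode → Set
  Reach = Star DEdge

  SameComp : DNode → DNode → Set
  SameComp c d = Reach c d × Reach d c

  IsSink : DNode → Set
  IsSink c = ∀ d e → SameComp c d → DEdge d e → SameComp c e

  start : Fin n → DNode
  start v = v , ⊥ , λ x x∈⊥ → ⊥-elim (∉⊥ x∈⊥)

  CompReachableFrom : DNode → DNode → Set
  CompReachableFrom a c = ∃ λ d → SameComp c d × Reach a d

  OnlySinkReachableFrom : DNode → DNode → Set
  OnlySinkReachableFrom a c =
    CompReachableFrom a c ×
    (∀ c′ → IsSink c′ → CompReachableFrom a c′ → SameComp c c′)

  Good : DNode → Set
  Good c = IsSink c × (∀ v → OnlySinkReachableFrom (start v) c)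

-- Fix a node v₀ and a closed walk at v₀ that starts with an edge and visits every node; it
-- exists since G is connected and has at least two nodes (an insert and a delete node).
-- Following it in dec(G) from any state X ⊆ U_{|V} always ends in the same state, because every
-- x ∈ U_{|V} labels some node and the last visit to such a node decides whether x is present.
-- So one node of dec(G) is reachable from all nodes; its component is then a sink component,
-- every sink component equals it, and it is reachable from each (v, ∅).

module Submission where

open import Defs
open import Data.Nat using (ℕ)
open import Data.Bool using (true; false)
open import Data.Bool.Properties using (∨-zeroʳ)
open import Data.Product using (∃; _×_; _,_; proj₁; proj₂; swap)
open import Data.Sum using (_⊎_; inj₁; inj₂)
open import Data.Empty using (⊥-elim)
open import Data.Fin using (Fin; _≟_)
open import Data.Fin.Subset using (Subset; ⊥; ⁅_⁆; _∈_)
open import Data.Fin.Subset.Properties using (∉⊥; x∈⁅x⁆; x∈⁅y⁆⇒x≡y; x∈p∪q⁻; p─q⊆p)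
open import Data.Vec using (Vec; lookup; zipWith; tabulate)
open import Data.Vec.Properties
  using (lookup-zipWith; lookup-replicate; tabulate∘lookup; tabulate-cong; []=⇒lookup; lookup⇒[]=)
open import Data.List using (List; []; _∷_; foldl; allFin)
open import Data.List.Relation.Unary.Any as Any using (Any; here; there)
open import Data.List.Membership.Propositional using () renaming (_∈_ to _∈ₗ_)
open import Data.List.Membership.Propositional.Properties using (∈-allFin)
open import Relation.Nullary using (¬_; yes; no)
open import Relation.Binary.PropositionalEquality
open import Relation.Binary.Construct.Closure.ReflexiveTransitive using (Star; ε; _◅_; _◅◅_)

lookup-ext : ∀ {A : Set} {k} {X Y : Vec A k} → (∀ i → lookup X i ≡ lookup Y i) → X ≡ Y
lookup-ext {X = X} {Y} eq = begin
  X                   ≡⟨ tabulate∘lookup X ⟨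
  tabulate (lookup X) ≡⟨ tabulate-cong eq ⟩
  tabulate (lookup Y) ≡⟨ tabulate∘lookup Y ⟩
  Y                   ∎
  where open ≡-Reasoning

module _ {A B C : Set} {k} {f : A → B → C} (X Y : Vec A k) (Z : Vec B k) (i : Fin k) where

  lookup-zipWith-≡ : f (lookup X i) (lookup Z i) ≡ f (lookup Y i) (lookup Z i) →
    lookup (zipWith f X Z) i ≡ lookup (zipWith f Y Z) i
  lookup-zipWith-≡ eq = trans (lookup-zipWith f i X Z) (trans eq (sym (lookup-zipWith f i Y Z)))

  lookup-zipWith-congˡ : lookup X i ≡ lookup Y i → lookup (zipWith f X Z) i ≡ lookup (zipWith f Y Z) i
  lookup-zipWith-congˡ eq = lookup-zipWith-≡ (cong (λ a → f a (lookup Z i)) eq)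

  lookup-zipWith-constˡ : ∀ {z} → lookup Z i ≡ z → (∀ a b → f a z ≡ f b z) →
    lookup (zipWith f X Z) i ≡ lookup (zipWith f Y Z) i
  lookup-zipWith-constˡ refl f-const = lookup-zipWith-≡ (f-const _ _)

lookup-⁅x⁆ : ∀ {k} (x : Fin k) → lookup ⁅ x ⁆ x ≡ true
lookup-⁅x⁆ x = []=⇒lookup (x∈⁅x⁆ x)

targets : ∀ {A : Set} {R : A → A → Set} {x y} → Star R x y → List A
targets ε = []
targets (_◅_ {j = j} _ p) = j ∷ targets p

∈-targets-◅◅ˡ : ∀ {A : Set} {R : A → A → Set} {x y z w} (p : Star R x y) {q : Star R y z} →
  w ∈ₗ targets p → w ∈ₗ targets (p ◅◅ q)
∈-targets-◅◅ˡ (_ ◅ p) (here refl) = here refl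
∈-targets-◅◅ˡ (_ ◅ p) (there w∈p) = there (∈-targets-◅◅ˡ p w∈p)

∈-targets-◅◅ʳ : ∀ {A : Set} {R : A → A → Set} {x y z w} (p : Star R x y) {q : Star R y z} →
  w ∈ₗ targets q → w ∈ₗ targets (p ◅◅ q)
∈-targets-◅◅ʳ ε w∈q = w∈q
∈-targets-◅◅ʳ (_ ◅ p) w∈q = there (∈-targets-◅◅ʳ p w∈q)

∈-targets-end : ∀ {A : Set} {R : A → A → Set} {x y} (p : Star R x y) → x ≡ y ⊎ y ∈ₗ targets p
∈-targets-end ε = inj₁ refl
∈-targets-end (_ ◅ p) with ∈-targets-end p
... | inj₁ refl = inj₂ (here refl)
... | inj₂ y∈p  = inj₂ (there y∈p)

first-step : ∀ {A : Set} {R : A → A → Set} {x y} → ¬ x ≡ y → Star R x y → ∃ (R x)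
first-step x≢x ε = ⊥-elim (x≢x refl)
first-step _ (r ◅ _) = _ , r

module _ {n m : ℕ} (G : EventGraph n m) where
  open EventGraph G

  Walk : Fin n → Fin n → Set
  Walk = Star (Adj G)

  WithinU : Subset m → Set
  WithinU X = ∀ x → x ∈ X → InU G x

  ⊥-withinU : WithinU ⊥
  ⊥-withinU _ x∈⊥ = ⊥-elim (∉⊥ x∈⊥)

  step-withinU : ∀ j {X} → WithinU X → WithinU (step G j X)
  step-withinU j {X} X⊆U x x∈jX with kind j
  ... | del = X⊆U x (p─q⊆p X ⁅ elem j ⁆ x∈jX)
  ... | ins with x∈p∪q⁻ X ⁅ elem j ⁆ x∈jX
  ...   | inj₁ x∈X    = X⊆U x x∈X
  ...   | inj₂ x∈elem = j , sym (x∈⁅y⁆⇒x≡y (elem j) x∈elem)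

  step-cong : ∀ j (X Y : Subset m) x → lookup X x ≡ lookup Y x →
    lookup (step G j X) x ≡ lookup (step G j Y) x
  step-cong j X Y x eq with kind j
  ... | ins = lookup-zipWith-congˡ X Y _ x eq
  ... | del = lookup-zipWith-congˡ X Y _ x eq

  step-resets : ∀ j (X Y : Subset m) → lookup (step G j X) (elem j) ≡ lookup (step G j Y) (elem j)
  step-resets j X Y with kind j
  ... | ins = lookup-zipWith-constˡ X Y _ (elem j) (lookup-⁅x⁆ (elem j))
                λ a b → trans (∨-zeroʳ a) (sym (∨-zeroʳ b))
  ... | del = lookup-zipWith-constˡ X Y _ (elem j) (lookup-⁅x⁆ (elem j)) λ _ _ → refl

  steps : List (Fin n) → Subset m → Subset m
  steps js X = foldl (λ Y j → step G j Y) X js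

  steps-withinU : ∀ js {X} → WithinU X → WithinU (steps js X)
  steps-withinU []       X⊆U = X⊆U
  steps-withinU (j ∷ js) X⊆U = steps-withinU js (step-withinU j X⊆U)

  steps-agree : ∀ js (X Y : Subset m) x → lookup X x ≡ lookup Y x ⊎ Any (λ j → elem j ≡ x) js →
    lookup (steps js X) x ≡ lookup (steps js Y) x
  steps-agree []       X Y x (inj₁ eq)          = eq
  steps-agree (j ∷ js) X Y x (inj₁ eq)          = steps-agree js _ _ x (inj₁ (step-cong j X Y x eq))
  steps-agree (j ∷ js) X Y x (inj₂ (here refl)) = steps-agree js _ _ x (inj₁ (step-resets j X Y))
  steps-agree (j ∷ js) X Y x (inj₂ (there hit)) = steps-agree js _ _ x (inj₂ hit)

  steps-forget : ∀ js → (∀ v → v ∈ₗ js) → ∀ {X} → WithinU X → steps js X ≡ steps js ⊥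
  steps-forget js covers {X} X⊆U = lookup-ext λ x → steps-agree js X ⊥ x (agree-or-hit x)
    where
    agree-or-hit : ∀ x → lookup X x ≡ lookup ⊥ x ⊎ Any (λ j → elem j ≡ x) js
    agree-or-hit x with lookup X x in x∈X
    ... | true  = let (v , v↦x) = X⊆U x (lookup⇒[]= x X x∈X) in
                  inj₂ (Any.map (λ { refl → v↦x }) (covers v))
    ... | false = inj₁ (sym (lookup-replicate x false))

  run : ∀ {u v} → Walk u v → SubU G → SubU G
  run p (X , X⊆U) = steps (targets p) X , steps-withinU (targets p) X⊆U

  reach-run : ∀ {u v} (p : Walk u v) X → Reach G (u , X) (v , run p X)
  reach-run ε X = ε
  reach-run (_◅_ {j = j} uj p) X = (uj , refl) ◅ reach-run p (run (uj ◅ ε) X)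

  -- The last edge only constrains the underlying subset of Y, not its proof of lying in U_{|V}.
  reach-run-◅ : ∀ {u j v} (uj : Adj G u j) (p : Walk j v) X Y →
    proj₁ Y ≡ steps (targets (uj ◅ p)) (proj₁ X) → Reach G (u , X) (v , Y)
  reach-run-◅ uj ε X Y eq = (uj , eq) ◅ ε
  reach-run-◅ uj (jk ◅ p) X Y eq = (uj , refl) ◅ reach-run-◅ jk p (run (uj ◅ ε) X) Y eq

  Root : DNode G → Set
  Root r = ∀ a → Reach G a r

  root-isSink : ∀ {r} → Root r → IsSink G r
  root-isSink reach-r d e (r↝d , _) d→e = (r↝d ◅◅ d→e ◅ ε) , reach-r e

  isSink-closed : ∀ {c d e} → IsSink G c → SameComp G c d → Reach G d e → SameComp G c e
  isSink-closed c-sink c~d ε = c~d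
  isSink-closed c-sink c~d (d→k ◅ k↝e) = isSink-closed c-sink (c-sink _ _ c~d d→k) k↝e

  isSink⇒sameComp-root : ∀ {r c} → Root r → IsSink G c → SameComp G c r
  isSink⇒sameComp-root reach-r c-sink = isSink-closed c-sink (ε , ε) (reach-r _)

  root-good : ∀ {r} → Root r → Good G r
  root-good reach-r = root-isSink reach-r , λ v →
    (_ , (ε , ε) , reach-r (start G v)) ,
    λ c′ c′-sink _ → swap (isSink⇒sameComp-root reach-r c′-sink)

  another-node : ∀ v → ∃ λ w → ¬ v ≡ w
  another-node v with hasIns v | hasDel v
  ... | i , _ , i-ins | d , _ , d-del with v ≟ i
  ...   | no v≢i   = i , v≢i
  ...   | yes refl = d , λ { refl → ins≢del (trans (sym i-ins) d-del) }
    where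
    ins≢del : ¬ ins ≡ del
    ins≢del ()

  neighbour : ∀ v → ∃ (Adj G v)
  neighbour v = let (w , v≢w) = another-node v in first-step v≢w (connected v w)

  v₀ : Fin n
  v₀ = nonempty

  v₁ : Fin n
  v₁ = proj₁ (neighbour v₀)

  v₀v₁ : Adj G v₀ v₁
  v₀v₁ = proj₂ (neighbour v₀)

  sweep : List (Fin n) → Walk v₁ v₀
  sweep []       = connected v₁ v₀
  sweep (v ∷ vs) = connected v₁ v ◅◅ connected v v₀ ◅◅ v₀v₁ ◅ sweep vs

  tour : Walk v₀ v₀
  tour = v₀v₁ ◅ sweep (allFin n)

  tour-covers : ∀ v → v ∈ₗ targets tour
  tour-covers v = sweep-covers (allFin n) (∈-allFin v)
    where
    sweep-covers : ∀ vs {v} → v ∈ₗ vs → v ∈ₗ targets (v₀v₁ ◅ sweep vs)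
    sweep-covers (v ∷ vs) (here refl) with ∈-targets-end (connected v₁ v)
    ... | inj₁ refl = here refl
    ... | inj₂ v∈   = there (∈-targets-◅◅ˡ (connected v₁ v) v∈)
    sweep-covers (w ∷ vs) (there v∈vs) =
      there (∈-targets-◅◅ʳ (connected v₁ w) (∈-targets-◅◅ʳ (connected w v₀) (sweep-covers vs v∈vs)))

  root : DNode G
  root = v₀ , run tour (⊥ , ⊥-withinU)

  reach-root : Root root
  reach-root (u , X) =
    reach-run to-v₀ X ◅◅ reach-run-◅ v₀v₁ (sweep (allFin n)) (run to-v₀ X) (proj₂ root)
    (sym (steps-forget (targets tour) tour-covers (proj₂ (run to-v₀ X))))
    where
    to-v₀ : Walk u v₀
    to-v₀ = connected u v₀

lemma2 : ∀ {n m : ℕ} (G : EventGraph n m) →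
    ∃ λ c → Good G c × (∀ c′ → Good G c′ → SameComp G c c′)
lemma2 G = root G , root-good G (reach-root G) ,
  λ c′ (c′-sink , _) → swap (isSink⇒sameComp-root G (reach-root G) c′-sink)
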